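{- Let $d\ge1$, $k\ge1$. The number of idempotents of $\wr_p^k\mathcal{IS}_d$ equals $F^k(1)=(((1+1)^d+1)^d\cdots+1)^d$ ($k$ applications), where $F(x)=(x+1)^d$ and $F^k$ is the $k$-fold iterate of $F$.
   Context: $\mathcal{IS}_d$ is the semigroup of all injective partial maps of $N_d=\{1,\dots,d\}$ (including the empty map), written on the right, $x(ab)=(xa)b$. For a semigroup $S$, $F(N_d,S)$ is the set of functions $f$ from a subset $\mathrm{dom}(f)\subseteq N_d$ to $S$ with $\mathrm{dom}(fg)=\mathrm{dom}(f)\cap\mathrm{dom}(g)$, $(fg)(x)=f(x)g(x)$; for $a\in\mathcal{IS}_d$, $\mathrm{dom}(f^a)=\{x\in\mathrm{dom}(a):xa\in\mathrm{dom}(f)\}$, $f^a(x)=f(xa)$. $S\wr_p\mathcal{IS}_d=\{(f,a)\in F(N_d,S)\times\mathcal{IS}_d:\mathrm{dom}(f)=\mathrm{dom}(a)\}$ with $(f,a)(g,b)=(fg^a,ab)$; $\wr_p^1\mathcal{IS}_d=\mathcal{IS}_d$ and $\wr_p^k\mathcal{IS}_d=(\wr_p^{k-1}\mathcal{IS}_d)\wr_p\mathcal{IS}_d$ for $k\ge2$. -}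

module Defs where

open import Data.Nat using (ℕ; zero; suc; _+_; _^_)
open import Data.Fin using (Fin; _≟_)
open import Data.Vec using (Vec; []; _∷_; lookup; tabulate)
open import Data.Maybe using (Maybe; just; nothing)
open import Data.Bool using (Bool; true; false; _∧_; not; T)
open import Data.Product using (Σ; _×_; _,_; proj₁; proj₂)
open import Data.Unit using (⊤; tt)
open import Relation.Nullary.Decidable using (⌊_⌋)
open import Relation.Binary.PropositionalEquality using (_≡_)

-- A semigroup presented concretely: a raw carrier, a multiplication on raw
-- elements, and a Boolean validity predicate cutting out the actual
-- elements (valid elements are closed under multiplication for the
-- semigroups constructed below).  T is proof-irrelevant, so
-- Σ Carrier (T ∘ valid) is the set of elements with ≡ as equality.
record Sg : Set₁ where
  field
    Carrier : Set
    _∙_     : Carrier → Carrier → Carrier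
    valid   : Carrier → Bool

open Sg public

Elem : Sg → Set
Elem S = Σ (Carrier S) (λ s → T (valid S s))

Idempotents : Sg → Set
Idempotents S = Σ (Elem S) (λ e → (_∙_ S) (proj₁ e) (proj₁ e) ≡ proj₁ e)

-- Injectivity check of a partial map N_d ⇀ N_d × A (given as the vector of
-- values), looking only at the N_d-components.
notIn : ∀ {d n} {A : Set} → Fin d → Vec (Maybe (Fin d × A)) n → Bool
notIn y [] = true
notIn y (nothing ∷ v) = notIn y v
notIn y (just (z , _) ∷ v) = not ⌊ y ≟ z ⌋ ∧ notIn y v

injB : ∀ {d n} {A : Set} → Vec (Maybe (Fin d × A)) n → Bool
injB [] = true
injB (nothing ∷ v) = injB v
injB (just (y , _) ∷ v) = notIn y v ∧ injB v

allValid : ∀ {d n} {A : Set} → (A → Bool) → Vec (Maybe (Fin d × A)) n → Bool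
allValid p [] = true
allValid p (nothing ∷ v) = allValid p v
allValid p (just (_ , s) ∷ v) = p s ∧ allValid p v

-- IS_d : an injective partial map a of N_d = Fin d is the vector
-- (xa)_{x ∈ N_d}, with nothing meaning x ∉ dom(a).  (The second
-- component ⊤ is a dummy.)  Maps are written on the right: x(ab) = (xa)b.
IS : ℕ → Sg
IS d = record
  { Carrier = Vec (Maybe (Fin d × ⊤)) d
  ; _∙_ = λ a b → tabulate λ x → compose (lookup a x) b
  ; valid = injB
  }
  where
  compose : Maybe (Fin d × ⊤) → Vec (Maybe (Fin d × ⊤)) d → Maybe (Fin d × ⊤)
  compose nothing b = nothing
  compose (just (y , _)) b = lookup b y

-- S ≀_p IS_d : a pair (f , a) with dom f = dom a is encoded as the vector
-- x ↦ (xa , f(x)) for x ∈ dom a, nothing otherwise.  The product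
-- (f,a)(g,b) = (f g^a , ab) has domain {x ∈ dom a : xa ∈ dom b},
-- value (x a b , f(x) g(xa)).
Wr : Sg → ℕ → Sg
Wr S d = record
  { Carrier = Vec (Maybe (Fin d × Carrier S)) d
  ; _∙_ = λ u v → tabulate λ x → mul (lookup u x) v
  ; valid = λ u → injB u ∧ allValid (valid S) u
  }
  where
  mul : Maybe (Fin d × Carrier S) → Vec (Maybe (Fin d × Carrier S)) d
      → Maybe (Fin d × Carrier S)
  mul nothing v = nothing
  mul (just (y , s)) v with lookup v y
  ... | nothing = nothing
  ... | just (z , t) = just (z , (_∙_ S) s t)

-- ≀_p^k IS_d  for k ≥ 1; the value at k = 0 is an unused placeholder.
wrPow : ℕ → ℕ → Sg
wrPow d zero = IS d
wrPow d (suc zero) = IS d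
wrPow d (suc (suc k)) = Wr (wrPow d (suc k)) d

F : ℕ → ℕ → ℕ
F d x = (x + 1) ^ d

iterF : ℕ → ℕ → ℕ → ℕ
iterF d zero x = x
iterF d (suc k) x = F d (iterF d k x)

-- An idempotent (f, a) of S ≀ IS_d forces a to be a partial identity: if xa = y
-- then idempotency gives ya = y, and injectivity of a gives x = y.  Then (f, a)²
-- = (f, a) says exactly that f(x) is idempotent for x ∈ dom a.  So an idempotent
-- is a choice, for each x ∈ N_d, of either "x ∉ dom a" or an idempotent of S,
-- and |E(S ≀ IS_d)| = (|E(S)| + 1)^d = F(|E(S)|).  Since IS_d is the wreath
-- product of the one-element semigroup with IS_d, induction on k gives F^k(1).
module Submission where

open import Defs
open import Data.Bool using (Bool; true; not; T)
open import Data.Bool.Properties using (T-∧; T-irrelevant)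
open import Data.Empty using (⊥-elim)
open import Data.Fin using (Fin; zero; suc; _≟_)
open import Data.Fin.Properties as Fin using (*↔×)
open import Data.Maybe as Maybe using (Maybe; just; nothing)
open import Data.Maybe.Properties using (just-injective) renaming (≡-dec to Maybe-≡-dec)
open import Data.Nat using (ℕ; zero; suc; _+_; _^_; _≤_)
open import Data.Nat.Properties using (+-comm)
open import Data.Product using (_×_; _,_; proj₁; proj₂; map₂)
open import Data.Product.Function.NonDependent.Propositional using (_×-↔_)
open import Data.Product.Properties using (,-injectiveˡ; ,-injectiveʳ) renaming (≡-dec to ×-≡-dec)
open import Data.Unit using (⊤; tt)
open import Data.Unit.Properties using () renaming (_≟_ to _≟⊤_)
open import Data.Vec using (Vec; []; _∷_; lookup; tabulate; replicate)
open import Data.Vec.Properties using (lookup∘tabulate; tabulate∘lookup; tabulate-cong)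
  renaming (≡-dec to Vec-≡-dec)
open import Function.Bundles using (_↔_; mk↔ₛ′; Inverse; Equivalence)
open import Function.Properties.Inverse using (↔-trans; ↔-sym)
open import Relation.Binary.Definitions using (DecidableEquality)
open import Relation.Binary.PropositionalEquality
open import Relation.Nullary using (Irrelevant; yes; no)
open import Relation.Nullary.Decidable using (⌊_⌋)
import Axiom.UniquenessOfIdentityProofs as UIP

lookup-ext : ∀ {A : Set} {n} {xs ys : Vec A n} → (∀ i → lookup xs i ≡ lookup ys i) → xs ≡ ys
lookup-ext {xs = xs} {ys} eq = begin
  xs                   ≡⟨ tabulate∘lookup xs ⟨
  tabulate (lookup xs) ≡⟨ tabulate-cong eq ⟩
  tabulate (lookup ys) ≡⟨ tabulate∘lookup ys ⟩
  ys                   ∎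
  where open ≡-Reasoning

Idempotents-≡ : (S : Sg) → DecidableEquality (Carrier S) → {e e′ : Idempotents S} →
                proj₁ (proj₁ e) ≡ proj₁ (proj₁ e′) → e ≡ e′
Idempotents-≡ S _≟S_ {(s , v) , p} {(.s , v′) , p′} refl
  rewrite T-irrelevant v v′ | UIP.Decidable⇒UIP.≡-irrelevant _≟S_ p p′ = refl

module _ {d : ℕ} {A : Set} where

  FstInjective : ∀ {n} → Vec (Maybe (Fin d × A)) n → Set
  FstInjective v = ∀ {i j y a b} → lookup v i ≡ just (y , a) → lookup v j ≡ just (y , b) → i ≡ j

  AllSnd : ∀ {n} → (A → Bool) → Vec (Maybe (Fin d × A)) n → Set
  AllSnd p v = ∀ {i y a} → lookup v i ≡ just (y , a) → T (p a)

  notIn-sound : ∀ {n y} (v : Vec (Maybe (Fin d × A)) n) → T (notIn y v) →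
                ∀ {j b} → lookup v j ≢ just (y , b)
  notIn-sound (nothing ∷ v) p {suc j} e = notIn-sound v p e
  notIn-sound {y = y} (just (z , _) ∷ v) p {zero} e with y ≟ z
  ... | yes _   = p  -- p : T (not true ∧ _), which is ⊥
  ... | no y≢z = y≢z (sym (,-injectiveˡ (just-injective e)))
  notIn-sound {y = y} (just (z , _) ∷ v) p {suc j} e =
    notIn-sound v (proj₂ (Equivalence.to (T-∧ {not ⌊ y ≟ z ⌋}) p)) e

  notIn-complete : ∀ {n} y (v : Vec (Maybe (Fin d × A)) n) →
                   (∀ {j b} → lookup v j ≢ just (y , b)) → T (notIn y v)
  notIn-complete y [] _ = tt
  notIn-complete y (nothing ∷ v) ∉v = notIn-complete y v (λ {j} → ∉v {suc j})
  notIn-complete y (just (z , c) ∷ v) ∉v with y ≟ z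
  ... | yes refl = ⊥-elim (∉v {zero} refl)
  ... | no _     = notIn-complete y v (λ {j} → ∉v {suc j})

  injB-sound : ∀ {n} (v : Vec (Maybe (Fin d × A)) n) → T (injB v) → FstInjective v
  injB-sound (nothing ∷ v) p {suc i} {suc j} eᵢ eⱼ = cong suc (injB-sound v p eᵢ eⱼ)
  injB-sound (just _ ∷ v) p {zero} {zero} _ _ = refl
  injB-sound (just (z , _) ∷ v) p {zero} {suc j} refl eⱼ =
    ⊥-elim (notIn-sound v (proj₁ (Equivalence.to (T-∧ {notIn z v}) p)) eⱼ)
  injB-sound (just (z , _) ∷ v) p {suc i} {zero} eᵢ refl =
    ⊥-elim (notIn-sound v (proj₁ (Equivalence.to (T-∧ {notIn z v}) p)) eᵢ)
  injB-sound (just (z , _) ∷ v) p {suc i} {suc j} eᵢ eⱼ =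
    cong suc (injB-sound v (proj₂ (Equivalence.to (T-∧ {notIn z v}) p)) eᵢ eⱼ)

  injB-complete : ∀ {n} (v : Vec (Maybe (Fin d × A)) n) → FstInjective v → T (injB v)
  injB-complete [] _ = tt
  injB-complete (nothing ∷ v) inj = injB-complete v (λ eᵢ eⱼ → Fin.suc-injective (inj eᵢ eⱼ))
  injB-complete (just (z , c) ∷ v) inj = Equivalence.from T-∧
    ( notIn-complete z v (λ {j} eⱼ → Fin.0≢1+n (inj {zero} {suc j} refl eⱼ))
    , injB-complete v (λ eᵢ eⱼ → Fin.suc-injective (inj eᵢ eⱼ)))

  allValid-sound : ∀ {n} (p : A → Bool) (v : Vec (Maybe (Fin d × A)) n) →
                   T (allValid p v) → AllSnd p v
  allValid-sound p (nothing ∷ v) q {suc i} e = allValid-sound p v q e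
  allValid-sound p (just (_ , c) ∷ v) q {zero} refl = proj₁ (Equivalence.to (T-∧ {p c}) q)
  allValid-sound p (just (_ , c) ∷ v) q {suc i} e =
    allValid-sound p v (proj₂ (Equivalence.to (T-∧ {p c}) q)) e

  allValid-complete : ∀ {n} (p : A → Bool) (v : Vec (Maybe (Fin d × A)) n) →
                      AllSnd p v → T (allValid p v)
  allValid-complete p [] _ = tt
  allValid-complete p (nothing ∷ v) all = allValid-complete p v (λ {i} → all {suc i})
  allValid-complete p (just _ ∷ v) all =
    Equivalence.from T-∧ (all {zero} refl , allValid-complete p v (λ {i} → all {suc i}))

module _ (S : Sg) where

  wrEntry : ∀ {d} → Maybe (Fin d × Carrier S) → Vec (Maybe (Fin d × Carrier S)) d →
            Maybe (Fin d × Carrier S)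
  wrEntry nothing        v = nothing
  wrEntry (just (y , s)) v = Maybe.map (map₂ (_∙_ S s)) (lookup v y)

  -- The multiplication of Wr is local to its definition; it is reached through
  -- a constant vector, whose product with v has the wanted entry at index zero.
  lookup-∙ : ∀ {d} (u v : Carrier (Wr S d)) x → lookup (_∙_ (Wr S d) u v) x ≡ wrEntry (lookup u x) v
  lookup-∙ {suc n} u v x = trans (lookup∘tabulate (λ i → at (lookup u i)) x) (entry (lookup u x))
    where
    at : Maybe (Fin (suc n) × Carrier S) → Maybe (Fin (suc n) × Carrier S)
    at m = lookup (_∙_ (Wr S (suc n)) (replicate (suc n) m) v) zero
    entry : ∀ m → at m ≡ wrEntry m v
    entry nothing = refl
    entry (just (y , _)) with lookup v y
    ... | nothing = refl
    ... | just _  = refl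

  IdempotentEntry : ∀ {d} → Fin d → Maybe (Fin d × Carrier S) → Set
  IdempotentEntry x nothing       = ⊤
  IdempotentEntry x (just (y , s)) = y ≡ x × T (valid S s) × _∙_ S s s ≡ s

  module _ {d : ℕ} (u : Carrier (Wr S d)) where

    fixed-entry : T (valid (Wr S d) u) → ∀ {x y s} → lookup u x ≡ just (y , s) →
                  wrEntry (just (y , s)) u ≡ just (y , s) → IdempotentEntry x (just (y , s))
    fixed-entry valid-u {x} {y} {s} uₓ fixed with lookup u y in u_y
    ... | just (z , t) =
      sym x≡y , allValid-sound (valid S) u valid-all uₓ , subst (λ w → _∙_ S s w ≡ s) t≡s st≡s
      where
      valid-all : T (allValid (valid S) u)
      valid-all = proj₂ (Equivalence.to (T-∧ {injB u}) valid-u)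
      st≡s : _∙_ S s t ≡ s
      st≡s = ,-injectiveʳ (just-injective fixed)
      x≡y : x ≡ y
      x≡y = injB-sound u (proj₁ (Equivalence.to (T-∧ {injB u}) valid-u))
              uₓ (trans u_y (cong (λ w → just (w , t)) (,-injectiveˡ (just-injective fixed))))
      t≡s : t ≡ s
      t≡s = ,-injectiveʳ (just-injective (trans (sym u_y) (subst (λ w → lookup u w ≡ just (y , s)) x≡y uₓ)))

    idempotent⇒entries : T (valid (Wr S d) u) → _∙_ (Wr S d) u u ≡ u →
                         ∀ x → IdempotentEntry x (lookup u x)
    idempotent⇒entries valid-u uu≡u x with lookup u x in uₓ
    ... | nothing      = tt
    ... | just (y , s) = fixed-entry valid-u uₓ (begin
      wrEntry (just (y , s)) u    ≡⟨ cong (λ m → wrEntry m u) uₓ ⟨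
      wrEntry (lookup u x) u      ≡⟨ lookup-∙ u u x ⟨
      lookup (_∙_ (Wr S d) u u) x ≡⟨ cong (λ w → lookup w x) uu≡u ⟩
      lookup u x                  ≡⟨ uₓ ⟩
      just (y , s)                ∎)
      where open ≡-Reasoning

    module _ (entries : ∀ x → IdempotentEntry x (lookup u x)) where

      entries⇒valid : T (valid (Wr S d) u)
      entries⇒valid = Equivalence.from T-∧
        ( injB-complete u (λ eᵢ eⱼ → trans (sym (proj₁ (entry eᵢ))) (proj₁ (entry eⱼ)))
        , allValid-complete (valid S) u (λ e → proj₁ (proj₂ (entry e))))
        where
        entry : ∀ {i y a} → lookup u i ≡ just (y , a) → IdempotentEntry i (just (y , a))
        entry {i} e = subst (IdempotentEntry i) e (entries i)

      entries⇒idempotent : _∙_ (Wr S d) u u ≡ u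
      entries⇒idempotent = lookup-ext λ x → trans (lookup-∙ u u x) (fixed x (lookup u x) refl (entries x))
        where
        fixed : ∀ x m → m ≡ lookup u x → IdempotentEntry x m → wrEntry m u ≡ m
        fixed x nothing       _  _               = refl
        fixed x (just (.x , s)) uₓ (refl , _ , ss≡s) =
          trans (cong (Maybe.map (map₂ (_∙_ S s))) (sym uₓ)) (cong (λ w → just (x , w)) ss≡s)

Wr-≟ : ∀ (S : Sg) {d} → DecidableEquality (Carrier S) → DecidableEquality (Carrier (Wr S d))
Wr-≟ S _≟S_ = Vec-≡-dec (Maybe-≡-dec (×-≡-dec _≟_ _≟S_))

module _ (S : Sg) (_≟S_ : DecidableEquality (Carrier S)) {d : ℕ} where

  IdempotentEntry-irrelevant : ∀ (x : Fin d) m → Irrelevant (IdempotentEntry S x m)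
  IdempotentEntry-irrelevant x nothing _ _ = refl
  IdempotentEntry-irrelevant x (just (y , s)) (p , v , q) (p′ , v′ , q′)
    rewrite UIP.Decidable⇒UIP.≡-irrelevant _≟_ p p′ | T-irrelevant v v′
          | UIP.Decidable⇒UIP.≡-irrelevant _≟S_ q q′ = refl

  toEntry : ∀ (x : Fin d) m → IdempotentEntry S x m → Maybe (Idempotents S)
  toEntry x nothing        _              = nothing
  toEntry x (just (_ , s)) (_ , v , ss≡s) = just ((s , v) , ss≡s)

  fromEntry : Fin d → Maybe (Idempotents S) → Maybe (Fin d × Carrier S)
  fromEntry x = Maybe.map (λ e → x , proj₁ (proj₁ e))

  fromEntry-idempotent : ∀ x e → IdempotentEntry S x (fromEntry x e)
  fromEntry-idempotent x nothing              = tt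
  fromEntry-idempotent x (just ((_ , v) , q)) = refl , v , q

  toEntry∘fromEntry : ∀ x e → toEntry x (fromEntry x e) (fromEntry-idempotent x e) ≡ e
  toEntry∘fromEntry x nothing  = refl
  toEntry∘fromEntry x (just _) = refl

  fromEntry∘toEntry : ∀ x m p → fromEntry x (toEntry x m p) ≡ m
  fromEntry∘toEntry x nothing        _             = refl
  fromEntry∘toEntry x (just (_ , s)) (y≡x , _ , _) = cong (λ w → just (w , s)) (sym y≡x)

  toEntry-cong : ∀ x {m m′} p p′ → m ≡ m′ → toEntry x m p ≡ toEntry x m′ p′
  toEntry-cong x {m} p p′ refl = cong (toEntry x m) (IdempotentEntry-irrelevant x m p p′)

  Idempotents-Wr↔Vec : Idempotents (Wr S d) ↔ Vec (Maybe (Idempotents S)) d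
  Idempotents-Wr↔Vec = mk↔ₛ′ to from to∘from from∘to
    where
    open ≡-Reasoning

    to : Idempotents (Wr S d) → Vec (Maybe (Idempotents S)) d
    to ((u , valid-u) , uu≡u) = tabulate λ x → toEntry x (lookup u x) (idempotent⇒entries S u valid-u uu≡u x)

    carrier : Vec (Maybe (Idempotents S)) d → Carrier (Wr S d)
    carrier g = tabulate λ x → fromEntry x (lookup g x)

    carrier-entries : ∀ g x → IdempotentEntry S x (lookup (carrier g) x)
    carrier-entries g x =
      subst (IdempotentEntry S x) (sym (lookup∘tabulate _ x)) (fromEntry-idempotent x (lookup g x))

    from : Vec (Maybe (Idempotents S)) d → Idempotents (Wr S d)
    from g = (carrier g , entries⇒valid S (carrier g) (carrier-entries g))
           , entries⇒idempotent S (carrier g) (carrier-entries g)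

    to∘from : ∀ g → to (from g) ≡ g
    to∘from g = lookup-ext λ x → begin
      lookup (to (from g)) x
        ≡⟨ lookup∘tabulate _ x ⟩
      toEntry x (lookup (carrier g) x) _
        ≡⟨ toEntry-cong x _ _ (lookup∘tabulate _ x) ⟩
      toEntry x (fromEntry x (lookup g x)) (fromEntry-idempotent x (lookup g x))
        ≡⟨ toEntry∘fromEntry x (lookup g x) ⟩
      lookup g x ∎

    from∘to : ∀ e → from (to e) ≡ e
    from∘to e@((u , valid-u) , uu≡u) = Idempotents-≡ (Wr S d) (Wr-≟ S _≟S_) (lookup-ext λ x → begin
      lookup (carrier (to e)) x       ≡⟨ lookup∘tabulate _ x ⟩
      fromEntry x (lookup (to e) x)   ≡⟨ cong (fromEntry x) (lookup∘tabulate _ x) ⟩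
      fromEntry x (toEntry x (lookup u x) _) ≡⟨ fromEntry∘toEntry x (lookup u x) _ ⟩
      lookup u x                      ∎)

Maybe↔Fin : ∀ {X : Set} {N} → X ↔ Fin N → Maybe X ↔ Fin (N + 1)
Maybe↔Fin {X} {N} X↔N = subst (λ n → Maybe X ↔ Fin n) (+-comm 1 N) (mk↔ₛ′ to from to∘from from∘to)
  where
  open Inverse X↔N renaming (to to toX; from to fromX)
  to : Maybe X → Fin (suc N)
  to nothing  = zero
  to (just x) = suc (toX x)
  from : Fin (suc N) → Maybe X
  from zero    = nothing
  from (suc i) = just (fromX i)
  to∘from : ∀ i → to (from i) ≡ i
  to∘from zero    = refl
  to∘from (suc i) = cong suc (strictlyInverseˡ i)
  from∘to : ∀ m → from (to m) ≡ m
  from∘to nothing  = refl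
  from∘to (just x) = cong just (strictlyInverseʳ x)

Vec↔Fin^ : ∀ {X : Set} {N} m → X ↔ Fin N → Vec X m ↔ Fin (N ^ m)
Vec↔Fin^ zero    _   = mk↔ₛ′ (λ _ → zero) (λ _ → []) (λ { zero → refl }) (λ { [] → refl })
Vec↔Fin^ {X} {N} (suc m) X↔N = ↔-trans uncons (↔-trans (X↔N ×-↔ Vec↔Fin^ m X↔N) (↔-sym (*↔× {N} {N ^ m})))
  where
  uncons : Vec X (suc m) ↔ (X × Vec X m)
  uncons = mk↔ₛ′ (λ { (x ∷ xs) → x , xs }) (λ (x , xs) → x ∷ xs) (λ _ → refl) (λ { (_ ∷ _) → refl })

Idempotents-Wr↔Fin : ∀ (S : Sg) {d N} → DecidableEquality (Carrier S) →
                     Idempotents S ↔ Fin N → Idempotents (Wr S d) ↔ Fin (F d N)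
Idempotents-Wr↔Fin S {d} _≟S_ S↔N = ↔-trans (Idempotents-Wr↔Vec S _≟S_) (Vec↔Fin^ d (Maybe↔Fin S↔N))

trivialSg : Sg
trivialSg = record { Carrier = ⊤ ; _∙_ = λ _ _ → tt ; valid = λ _ → true }

Idempotents-trivialSg↔Fin1 : Idempotents trivialSg ↔ Fin 1
Idempotents-trivialSg↔Fin1 =
  mk↔ₛ′ (λ _ → zero) (λ _ → (tt , tt) , refl) (λ { zero → refl }) (λ { ((tt , tt) , refl) → refl })

lookup-IS-∙ : ∀ {d} (u v : Carrier (IS d)) x → lookup (_∙_ (IS d) u v) x ≡ wrEntry trivialSg (lookup u x) v
lookup-IS-∙ {suc n} u v x = trans (lookup∘tabulate (λ i → at (lookup u i)) x) (entry (lookup u x))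
  where
  at : Maybe (Fin (suc n) × ⊤) → Maybe (Fin (suc n) × ⊤)
  at m = lookup (_∙_ (IS (suc n)) (replicate (suc n) m) v) zero
  entry : ∀ m → at m ≡ wrEntry trivialSg m v
  entry nothing = refl
  entry (just (y , _)) with lookup v y
  ... | nothing = refl
  ... | just _  = refl

IS-∙ : ∀ {d} (u v : Carrier (IS d)) → _∙_ (IS d) u v ≡ _∙_ (Wr trivialSg d) u v
IS-∙ u v = lookup-ext λ x → trans (lookup-IS-∙ u v x) (sym (lookup-∙ trivialSg u v x))

Idempotents-IS↔Wr : ∀ {d} → Idempotents (IS d) ↔ Idempotents (Wr trivialSg d)
Idempotents-IS↔Wr {d} = mk↔ₛ′ to from
  (λ _ → Idempotents-≡ (Wr trivialSg d) (Wr-≟ trivialSg _≟⊤_) refl)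
  (λ _ → Idempotents-≡ (IS d) (Wr-≟ trivialSg _≟⊤_) refl)
  where
  to : Idempotents (IS d) → Idempotents (Wr trivialSg d)
  to ((u , inj) , uu≡u) =
    (u , Equivalence.from T-∧ (inj , allValid-complete _ u (λ _ → tt))) , trans (sym (IS-∙ u u)) uu≡u
  from : Idempotents (Wr trivialSg d) → Idempotents (IS d)
  from ((u , valid-u) , uu≡u) = (u , proj₁ (Equivalence.to (T-∧ {injB u}) valid-u)) , trans (IS-∙ u u) uu≡u

wrPow-≟ : ∀ d k → DecidableEquality (Carrier (wrPow d (suc k)))
wrPow-≟ d zero    = Wr-≟ trivialSg _≟⊤_
wrPow-≟ d (suc k) = Wr-≟ (wrPow d (suc k)) (wrPow-≟ d k)

Idempotents-wrPow↔Fin : ∀ d k → Idempotents (wrPow d (suc k)) ↔ Fin (iterF d (suc k) 1)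
Idempotents-wrPow↔Fin d zero =
  ↔-trans Idempotents-IS↔Wr (Idempotents-Wr↔Fin trivialSg _≟⊤_ Idempotents-trivialSg↔Fin1)
Idempotents-wrPow↔Fin d (suc k) =
  Idempotents-Wr↔Fin (wrPow d (suc k)) (wrPow-≟ d k) (Idempotents-wrPow↔Fin d k)

mainTheorem4 : (d k : ℕ) → 1 ≤ d → 1 ≤ k → Idempotents (wrPow d k) ↔ Fin (iterF d k 1)
mainTheorem4 d (suc k) _ _ = Idempotents-wrPow↔Fin d k
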